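{- Assume the $abc$ conjecture holds: for every $\varepsilon>0$ there are only finitely many triples $(a,b,c)$ of pairwise coprime positive integers with $a+b=c$ and $c>\operatorname{rad}(abc)^{1+\varepsilon}$. Then for every $\varepsilon>0$ there exists a constant $K(\varepsilon)>0$ such that $$ n \geq K(\varepsilon)\, 2^{(1-\varepsilon)j} \quad \text{for all integers } j\geq 2 \text{ and all } n\in\mathcal{N}(j).$$
   Context: $\operatorname{rad}(m)$ denotes the product of the distinct prime factors of a positive integer $m$. The Collatz map is $T(n)=(3n+1)/2$ if $n$ is odd and $T(n)=n/2$ if $n$ is even, with $T^0(n)=n$ and $T^{i}$ the $i$-th iterate. For an integer $j\geq 2$, $\mathcal{N}(j)$ is the set of positive integers $n<2^j$ such that among the $j$ terms $n, T(n),\ldots,T^{j-1}(n)$ exactly one is even.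
   Formalization: The parameter ε in the conclusion ranges only over the positive rationals, and the constant K(ε) is taken in the positive rationals. -}

module Defs where

open import Data.Nat using (ℕ; zero; suc; _+_; _*_; _^_; _≤_; _<_; _≡ᵇ_)
open import Data.Nat.DivMod using (_/_; _%_)
open import Data.Nat.Divisibility using (_∣?_)
open import Data.Nat.Primality using (prime?)
open import Data.Nat.Coprimality using (Coprime)
open import Data.Bool using (Bool; true; false; if_then_else_; _∧_)
open import Data.List using (List; map; upTo)
open import Data.Nat.ListAction using (product)
open import Data.List.Membership.Propositional using (_∈_)
open import Data.Product using (_×_; _,_; ∃)
open import Relation.Nullary.Decidable using (⌊_⌋)
open import Relation.Binary.PropositionalEquality using (_≡_)

-- rad m = product of the distinct primes dividing m (all primes are ≤ m when m ≥ 1;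
-- upTo (suc m) = [0 .. m]).
rad : ℕ → ℕ
rad m = product (map f (upTo (suc m)))
  where
  f : ℕ → ℕ
  f p = if ⌊ prime? p ⌋ ∧ ⌊ p ∣? m ⌋ then p else 1

isEven : ℕ → Bool
isEven n = n % 2 ≡ᵇ 0

T : ℕ → ℕ
T n = if isEven n then n / 2 else (3 * n + 1) / 2

Tⁱ : ℕ → ℕ → ℕ
Tⁱ zero n = n
Tⁱ (suc i) n = Tⁱ i (T n)

evenCount : ℕ → ℕ → ℕ
evenCount zero n = 0
evenCount (suc j) n = (if isEven n then 1 else 0) + evenCount j (T n)

InN : ℕ → ℕ → Set
InN j n = (0 < n) × (n < 2 ^ j) × (evenCount j n ≡ 1)

-- abc conjecture, with ε = p/q rational (c > rad(abc)^{1+p/q}  ⇔  c^q > rad(abc)^{q+p});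
-- "only finitely many triples" = all of them occur in some finite list.
ABC : Set
ABC = ∀ (p q : ℕ) → 0 < p → 0 < q →
  ∃ λ (L : List (ℕ × ℕ × ℕ)) →
    ∀ (a b c : ℕ) → 0 < a → 0 < b → 0 < c →
      Coprime a b → Coprime a c → Coprime b c → a + b ≡ c →
      rad (a * b * c) ^ (q + p) < c ^ q → (a , b , c) ∈ L

{-# OPTIONS --safe #-}
-- If n ∈ 𝒩(j), the orbit makes k odd steps, one even step and r odd steps, j = k + 1 + r.
-- An odd step sends x + 1 to 3(x + 1)/2, so n + 1 = 2ᵏm, the even term is 3ᵏm − 1, and
-- r further odd steps force 3ᵏm + 1 = 2ʳ⁺¹s. The radical of the abc triple (1, 3ᵏm, 3ᵏm + 1)
-- divides 6ms, so abc with exponent 1 + p/2q gives (2ʳ⁺¹s)^2q ≤ (6ms)^(2q+p) up to finitely many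
-- triples, which only bound 2ʲ by a constant times n. Cancelling s^2q and using s ≤ 2·4ᵏm,
-- 2ᵏm = n + 1 ≤ 2ʲ gives 2^(2qj) ≤ 12^(2q+p) n^2q 2^(2pj), whose square root is the claim.
module Submission where

open import Defs
open import Data.Bool using (true; false; if_then_else_; _∧_)
open import Data.List using (map; upTo; _∷_; []; _++_)
open import Data.List.Membership.Propositional.Properties using (∈-map⁺)
open import Data.List.Properties using (applyUpTo-∷ʳ; map-++)
open import Data.List.Relation.Unary.All using (lookup)
open import Data.Nat
open import Data.Nat.Coprimality as Coprimality using (Coprime; coprime-divisor; 1-coprimeTo; coprime-+)
open import Data.Nat.DivMod using (_/_; _%_; m*n/n≡m; m*n%n≡0; [m+kn]%n≡m%n)
open import Data.Nat.Divisibility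
open import Data.Nat.ListAction using (product)
open import Data.Nat.ListAction.Properties using (product-++)
open import Data.Nat.Primality
open import Data.Nat.Properties
open import Algebra.Properties.CommutativeSemigroup *-commutativeSemigroup using (interchange; x∙yz≈yx∙z; x∙yz≈z∙xy; x∙yz≈y∙xz; xy∙z≈xz∙y)
open import Data.List.Extrema ≤-totalOrder using (max; xs≤max)
open import Data.Nat.Tactic.RingSolver using (solve-∀)
open import Data.Product using (_×_; _,_; ∃; ∃₂; ∃-syntax)
open import Data.Sum using (_⊎_; inj₁; inj₂; [_,_])
open import Function using (id; _∘_)
open import Relation.Nullary using (¬_; yes; no; contradiction)
open import Relation.Nullary.Decidable using (⌊_⌋; from-yes)
open import Relation.Binary.PropositionalEquality using (_≡_; refl; sym; trans; cong; cong₂; subst; subst₂; module ≡-Reasoning)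

^-distribʳ-* : ∀ m n e → (m * n) ^ e ≡ m ^ e * n ^ e
^-distribʳ-* m n zero    = refl
^-distribʳ-* m n (suc e) = begin
  m * n * (m * n) ^ e      ≡⟨ cong (m * n *_) (^-distribʳ-* m n e) ⟩
  m * n * (m ^ e * n ^ e)  ≡⟨ interchange m n (m ^ e) (n ^ e) ⟩
  m * m ^ e * (n * n ^ e)  ∎
  where open ≡-Reasoning

m≤m^n : ∀ m n .{{_ : NonZero m}} .{{_ : NonZero n}} → m ≤ m ^ n
m≤m^n m (suc n) = m≤m*n m (m ^ n) {{m^n≢0 m n}}

m*m≤n*n⇒m≤n : ∀ {m n} → m * m ≤ n * n → m ≤ n
m*m≤n*n⇒m≤n mm≤nn = ≮⇒≥ λ n<m → <⇒≱ (*-mono-< n<m n<m) mm≤nn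

prime∤1 : ∀ {p} → Prime p → ¬ p ∣ 1
prime∤1 pp p∣1 = ¬prime[1] (subst Prime (∣1⇒≡1 p∣1) pp)

prime∤⇒coprime : ∀ {p n} → Prime p → ¬ p ∣ n → Coprime p n
prime∤⇒coprime pp p∤n (d∣p , d∣n) with prime⇒irreducible pp d∣p
... | inj₁ d≡1 = d≡1
... | inj₂ refl = contradiction d∣n p∤n

prime∣^⇒prime∣ : ∀ {p} m n → Prime p → p ∣ m ^ n → p ∣ m
prime∣^⇒prime∣ m zero    pp p∣1    = contradiction p∣1 (prime∤1 pp)
prime∣^⇒prime∣ m (suc n) pp p∣m^n = [ id , prime∣^⇒prime∣ m n pp ] (euclidsLemma m (m ^ n) pp p∣m^n)

coprime⇒*∣ : ∀ {m n y} → Coprime m n → m ∣ y → n ∣ y → m * n ∣ y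
coprime⇒*∣ {m} {n} c m∣y (divides t refl) with coprime-divisor c (subst (m ∣_) (*-comm t n) m∣y)
... | divides t′ refl = divides t′ (*-assoc t′ m n)

coprime-suc : ∀ b → Coprime b (suc b)
coprime-suc b = subst (Coprime b) (+-comm b 1) (Coprimality.sym (coprime-+ (1-coprimeTo b)))

2^n-coprime-3 : ∀ n → Coprime (2 ^ n) 3
2^n-coprime-3 n = Coprimality.sym (prime∤⇒coprime prime[3] λ 3∣2^n → >⇒∤ ≤-refl (prime∣^⇒prime∣ 2 n prime[3] 3∣2^n))
  where
  prime[3] : Prime 3
  prime[3] = from-yes (prime? 3)

radFactor : ℕ → ℕ → ℕ
radFactor x p = if ⌊ prime? p ⌋ ∧ ⌊ p ∣? x ⌋ then p else 1

radUpTo : ℕ → ℕ → ℕ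
radUpTo x N = product (map (radFactor x) (upTo N))

radFactor-cases : ∀ x p → radFactor x p ≡ 1 ⊎ (Prime p × p ∣ x × radFactor x p ≡ p)
radFactor-cases x p with prime? p | p ∣? x
... | yes pp | yes p∣x = inj₂ (pp , p∣x , refl)
... | yes _  | no _    = inj₁ refl
... | no _   | _       = inj₁ refl

radUpTo-suc : ∀ x N → radUpTo x (suc N) ≡ radUpTo x N * radFactor x N
radUpTo-suc x N = begin
  product (map (radFactor x) (upTo (suc N)))          ≡⟨ cong (product ∘ map (radFactor x)) (sym (applyUpTo-∷ʳ id N)) ⟩
  product (map (radFactor x) (upTo N ++ N ∷ []))      ≡⟨ cong product (map-++ (radFactor x) (upTo N) (N ∷ [])) ⟩
  product (map (radFactor x) (upTo N) ++ radFactor x N ∷ [])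
                                                      ≡⟨ product-++ (map (radFactor x) (upTo N)) (radFactor x N ∷ []) ⟩
  radUpTo x N * (radFactor x N * 1)                   ≡⟨ cong (radUpTo x N *_) (*-identityʳ _) ⟩
  radUpTo x N * radFactor x N                         ∎
  where open ≡-Reasoning

prime∣radUpTo⇒< : ∀ {p} x N → Prime p → p ∣ radUpTo x N → p < N
prime∣radUpTo⇒< x zero    pp p∣1 = contradiction p∣1 (prime∤1 pp)
prime∣radUpTo⇒< {p} x (suc N) pp p∣rad
  with euclidsLemma (radUpTo x N) (radFactor x N) pp (subst (p ∣_) (radUpTo-suc x N) p∣rad)
... | inj₁ p∣rad′ = m<n⇒m<1+n (prime∣radUpTo⇒< x N pp p∣rad′)
... | inj₂ p∣f with radFactor-cases x N
...   | inj₁ f≡1            = contradiction (subst (p ∣_) f≡1 p∣f) (prime∤1 pp)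
...   | inj₂ (pN , _ , f≡N) = s≤s (∣⇒≤ {{prime⇒nonZero pN}} (subst (p ∣_) f≡N p∣f))

radUpTo-∣ : ∀ {x y} → (∀ {p} → Prime p → p ∣ x → p ∣ y) → ∀ N → radUpTo x N ∣ y
radUpTo-∣ H zero = 1∣ _
radUpTo-∣ {x} {y} H (suc N) rewrite radUpTo-suc x N with radFactor-cases x N
... | inj₁ f≡1 rewrite f≡1 | *-identityʳ (radUpTo x N) = radUpTo-∣ H N
... | inj₂ (pN , N∣x , f≡N) rewrite f≡N =
  coprime⇒*∣ (Coprimality.sym N⊥rad) (radUpTo-∣ H N) (H pN N∣x)
  where
  N⊥rad : Coprime N (radUpTo x N)
  N⊥rad = prime∤⇒coprime pN λ N∣rad → <-irrefl refl (prime∣radUpTo⇒< x N pN N∣rad)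

rad-≤ : ∀ {x y} .{{_ : NonZero y}} → (∀ {p} → Prime p → p ∣ x → p ∣ y) → rad x ≤ y
rad-≤ {x} H = ∣⇒≤ (radUpTo-∣ H (suc x))

rad[aᵏm*bᵗs]≤abms : ∀ a b k t m s .{{_ : NonZero (a * b * m * s)}} →
  rad (a ^ k * m * (b ^ t * s)) ≤ a * b * m * s
rad[aᵏm*bᵗs]≤abms a b k t m s = rad-≤ divides-abms
  where
  divides-abms : ∀ {p} → Prime p → p ∣ a ^ k * m * (b ^ t * s) → p ∣ a * b * m * s
  divides-abms pp p∣x with euclidsLemma (a ^ k * m) (b ^ t * s) pp p∣x
  ... | inj₁ p∣aᵏm with euclidsLemma (a ^ k) m pp p∣aᵏm
  ...   | inj₁ p∣aᵏ = ∣m⇒∣m*n s (∣m⇒∣m*n m (∣m⇒∣m*n b (prime∣^⇒prime∣ a k pp p∣aᵏ)))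
  ...   | inj₂ p∣m  = ∣m⇒∣m*n s (∣n⇒∣m*n (a * b) p∣m)
  divides-abms pp p∣x | inj₂ p∣bᵗs with euclidsLemma (b ^ t) s pp p∣bᵗs
  ...   | inj₁ p∣bᵗ = ∣m⇒∣m*n s (∣m⇒∣m*n m (∣n⇒∣m*n a (prime∣^⇒prime∣ b t pp p∣bᵗ)))
  ...   | inj₂ p∣s  = ∣n⇒∣m*n (a * b * m) p∣s

data EvenOdd : ℕ → Set where
  even : ∀ u → EvenOdd (2 * u)
  odd  : ∀ u → EvenOdd (1 + 2 * u)

evenOdd : ∀ x → EvenOdd x
evenOdd zero = even 0
evenOdd (suc x) with evenOdd x
... | even u = odd u
... | odd u  = subst EvenOdd (*-suc 2 u) (even (suc u))

isEven-even : ∀ u → isEven (2 * u) ≡ true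
isEven-even u = cong (_≡ᵇ 0) (trans (cong (_% 2) (*-comm 2 u)) (m*n%n≡0 u 2))

isEven-odd : ∀ u → isEven (1 + 2 * u) ≡ false
isEven-odd u = cong (_≡ᵇ 0) (trans (cong (λ v → (1 + v) % 2) (*-comm 2 u)) ([m+kn]%n≡m%n 1 u 2))

T-even : ∀ u → T (2 * u) ≡ u
T-even u rewrite isEven-even u = trans (cong (_/ 2) (*-comm 2 u)) (m*n/n≡m u 2)

T-odd : ∀ u → T (1 + 2 * u) ≡ 2 + 3 * u
T-odd u rewrite isEven-odd u = trans (cong (_/ 2) (3[1+2u]+1≡[2+3u]*2 u)) (m*n/n≡m (2 + 3 * u) 2)
  where
  3[1+2u]+1≡[2+3u]*2 : ∀ u → 3 * (1 + 2 * u) + 1 ≡ (2 + 3 * u) * 2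
  3[1+2u]+1≡[2+3u]*2 = solve-∀

evenCount-even : ∀ t u → evenCount (suc t) (2 * u) ≡ suc (evenCount t u)
evenCount-even t u = cong₂ _+_ (cong (λ b → if b then 1 else 0) (isEven-even u)) (cong (evenCount t) (T-even u))

evenCount-odd : ∀ t u → evenCount (suc t) (1 + 2 * u) ≡ evenCount t (2 + 3 * u)
evenCount-odd t u = cong₂ _+_ (cong (λ b → if b then 1 else 0) (isEven-odd u)) (cong (evenCount t) (T-odd u))

3v≡2ᵗm⇒v≡2ᵗm′ : ∀ t v m → 3 * v ≡ 2 ^ t * m → ∃[ m′ ] (v ≡ 2 ^ t * m′ × m ≡ 3 * m′)
3v≡2ᵗm⇒v≡2ᵗm′ t v m 3v≡2ᵗm with coprime-divisor (2^n-coprime-3 t) (divides m (trans 3v≡2ᵗm (*-comm (2 ^ t) m)))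
... | divides m′ v≡m′2ᵗ = m′ , trans v≡m′2ᵗ (*-comm m′ (2 ^ t)) , *-cancelˡ-≡ m (3 * m′) (2 ^ t) {{m^n≢0 2 t}} (begin
  2 ^ t * m         ≡⟨ sym 3v≡2ᵗm ⟩
  3 * v             ≡⟨ cong (3 *_) v≡m′2ᵗ ⟩
  3 * (m′ * 2 ^ t)  ≡⟨ x∙yz≈z∙xy 3 m′ (2 ^ t) ⟩
  2 ^ t * (3 * m′)  ∎)
  where open ≡-Reasoning

odd-run : ∀ t x → evenCount t x ≡ 0 → ∃[ m ] (suc x ≡ 2 ^ t * m × suc (Tⁱ t x) ≡ 3 ^ t * m)
odd-run zero    x _ = suc x , sym (*-identityˡ _) , sym (*-identityˡ _)
odd-run (suc t) x noEven with evenOdd x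
... | even u = contradiction (trans (sym (evenCount-even t u)) noEven) λ ()
... | odd u with odd-run t (2 + 3 * u) (trans (sym (evenCount-odd t u)) noEven)
...   | m , 3+3u≡2ᵗm , end≡3ᵗm with 3v≡2ᵗm⇒v≡2ᵗm′ t (suc u) m (trans (*-suc 3 u) 3+3u≡2ᵗm)
...     | m′ , 1+u≡2ᵗm′ , m≡3m′ = m′ , start , end
  where
  open ≡-Reasoning
  start : suc (1 + 2 * u) ≡ 2 ^ suc t * m′
  start = begin
    2 + 2 * u         ≡⟨ *-suc 2 u ⟨
    2 * suc u         ≡⟨ cong (2 *_) 1+u≡2ᵗm′ ⟩
    2 * (2 ^ t * m′)  ≡⟨ *-assoc 2 (2 ^ t) m′ ⟨
    2 ^ suc t * m′    ∎
  end : suc (Tⁱ (suc t) (1 + 2 * u)) ≡ 3 ^ suc t * m′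
  end = begin
    suc (Tⁱ t (T (1 + 2 * u)))  ≡⟨ cong (suc ∘ Tⁱ t) (T-odd u) ⟩
    suc (Tⁱ t (2 + 3 * u))      ≡⟨ end≡3ᵗm ⟩
    3 ^ t * m                   ≡⟨ cong (3 ^ t *_) m≡3m′ ⟩
    3 ^ t * (3 * m′)            ≡⟨ x∙yz≈yx∙z (3 ^ t) 3 m′ ⟩
    3 ^ suc t * m′              ∎

split-at-even : ∀ j n → evenCount j n ≡ 1 →
  ∃₂ λ k r → j ≡ k + suc r × evenCount k n ≡ 0 × ∃[ w ] (Tⁱ k n ≡ 2 * w × evenCount r w ≡ 0)
split-at-even (suc j) n one with evenOdd n
... | even u = 0 , j , refl , refl , u , refl , suc-injective (trans (sym (evenCount-even j u)) one)
... | odd u with split-at-even j (2 + 3 * u) (trans (sym (evenCount-odd j u)) one)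
...   | k , r , j≡k+1+r , none , w , xₖ≡2w , rest =
  suc k , r , cong suc j≡k+1+r , trans (evenCount-odd k u) none ,
  w , trans (cong (Tⁱ k) (T-odd u)) xₖ≡2w , rest

record SingleEvenOrbit (j n : ℕ) : Set where
  field
    k r m s    : ℕ
    j≡k+1+r    : j ≡ k + suc r
    1+n≡2ᵏm    : suc n ≡ 2 ^ k * m
    1+3ᵏm≡2ʳ⁺¹s : suc (3 ^ k * m) ≡ 2 ^ suc r * s

single-even-orbit : ∀ j n → evenCount j n ≡ 1 → SingleEvenOrbit j n
single-even-orbit j n one with split-at-even j n one
... | k , r , j≡k+1+r , none , w , xₖ≡2w , rest with odd-run k n none | odd-run r w rest
...   | m , 1+n≡2ᵏm , 1+xₖ≡3ᵏm | s , 1+w≡2ʳs , _ = record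
  { k = k ; r = r ; m = m ; s = s
  ; j≡k+1+r = j≡k+1+r ; 1+n≡2ᵏm = 1+n≡2ᵏm ; 1+3ᵏm≡2ʳ⁺¹s = 1+3ᵏm≡2ʳ⁺¹s }
  where
  open ≡-Reasoning
  1+3ᵏm≡2ʳ⁺¹s : suc (3 ^ k * m) ≡ 2 ^ suc r * s
  1+3ᵏm≡2ʳ⁺¹s = begin
    suc (3 ^ k * m)      ≡⟨ cong suc 1+xₖ≡3ᵏm ⟨
    2 + Tⁱ k n           ≡⟨ cong (2 +_) xₖ≡2w ⟩
    2 + 2 * w            ≡⟨ *-suc 2 w ⟨
    2 * suc w            ≡⟨ cong (2 *_) 1+w≡2ʳs ⟩
    2 * (2 ^ r * s)      ≡⟨ *-assoc 2 (2 ^ r) s ⟨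
    2 ^ suc r * s        ∎

ConsecutiveABC : ℕ → ℕ → ℕ → Set
ConsecutiveABC p Q M = ∀ b → 0 < b → suc b ≤ M ⊎ suc b ^ Q ≤ rad (1 * b * suc b) ^ (Q + p)

abc⇒consecutiveABC : ABC → ∀ p Q → 0 < p → 0 < Q → ∃ (ConsecutiveABC p Q)
abc⇒consecutiveABC abc p Q p>0 Q>0 with abc p Q p>0 Q>0
... | L , exceptional = max 0 (map third L) , dichotomy
  where
  third : ℕ × ℕ × ℕ → ℕ
  third (_ , _ , c) = c
  dichotomy : ConsecutiveABC p Q (max 0 (map third L))
  dichotomy b b>0 with rad (1 * b * suc b) ^ (Q + p) <? suc b ^ Q
  ... | no ¬radᴾ<c = inj₂ (≮⇒≥ ¬radᴾ<c)
  ... | yes radᴾ<c = inj₁ (lookup (xs≤max 0 (map third L)) (∈-map⁺ third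
          (exceptional 1 b (suc b) z<s b>0 z<s (1-coprimeTo b) (1-coprimeTo (suc b)) (coprime-suc b) refl radᴾ<c)))

small-exception-bound : ∀ {A R m s n M} .{{_ : NonZero m}} .{{_ : NonZero s}} .{{_ : NonZero n}} →
  suc n ≡ A * m → R * s ≤ M → A * R ≤ n * (2 * M)
small-exception-bound {A} {R} {m} {s} {n} {M} 1+n≡Am Rs≤M = begin
  A * R            ≤⟨ *-mono-≤ (m≤m*n A m) (m≤m*n R s) ⟩
  A * m * (R * s)  ≡⟨ cong (_* (R * s)) 1+n≡Am ⟨
  suc n * (R * s)  ≤⟨ *-mono-≤ (+-monoˡ-≤ n (>-nonZero⁻¹ n)) Rs≤M ⟩
  (n + n) * M      ≡⟨ [n+n]*M≡n*[2*M] n M ⟩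
  n * (2 * M)      ∎
  where
  open ≤-Reasoning
  [n+n]*M≡n*[2*M] : ∀ n M → (n + n) * M ≡ n * (2 * M)
  [n+n]*M≡n*[2*M] = solve-∀

cancel-common-factor : ∀ {x y s} Q p .{{_ : NonZero s}} →
  (x * s) ^ Q ≤ (y * s) ^ (Q + p) → x ^ Q ≤ y ^ Q * (y * s) ^ p
cancel-common-factor {x} {y} {s} Q p h =
  *-cancelʳ-≤ (x ^ Q) (y ^ Q * (y * s) ^ p) (s ^ Q) {{m^n≢0 s Q}} (begin
    x ^ Q * s ^ Q                ≡⟨ ^-distribʳ-* x s Q ⟨
    (x * s) ^ Q                  ≤⟨ h ⟩
    (y * s) ^ (Q + p)            ≡⟨ ^-distribˡ-+-* (y * s) Q p ⟩
    (y * s) ^ Q * (y * s) ^ p    ≡⟨ cong (_* (y * s) ^ p) (^-distribʳ-* y s Q) ⟩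
    y ^ Q * s ^ Q * (y * s) ^ p  ≡⟨ xy∙z≈xz∙y (y ^ Q) (s ^ Q) ((y * s) ^ p) ⟩
    y ^ Q * (y * s) ^ p * s ^ Q  ∎)
  where open ≤-Reasoning

power-squares : ∀ c n Z q p .{{_ : NonZero c}} →
  (c * n) ^ (q + q) * (c * (Z * Z)) ^ p ≤ c ^ (q + p) * (n ^ q * Z ^ p) * (c ^ (q + p) * (n ^ q * Z ^ p))
power-squares c n Z q p = begin
  (c * n) ^ (q + q) * (c * (Z * Z)) ^ p
    ≡⟨ cong₂ _*_ (trans (^-distribʳ-* c n (q + q)) (cong₂ _*_ (^-distribˡ-+-* c q q) (^-distribˡ-+-* n q q)))
                 (trans (^-distribʳ-* c (Z * Z) p) (cong (c ^ p *_) (^-distribʳ-* Z Z p))) ⟩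
  c ^ q * c ^ q * (n ^ q * n ^ q) * (c ^ p * (Z ^ p * Z ^ p))
    ≤⟨ *-monoʳ-≤ (c ^ q * c ^ q * (n ^ q * n ^ q)) (*-monoˡ-≤ (Z ^ p * Z ^ p) (m≤m*n (c ^ p) (c ^ p) {{m^n≢0 c p}})) ⟩
  c ^ q * c ^ q * (n ^ q * n ^ q) * (c ^ p * c ^ p * (Z ^ p * Z ^ p))
    ≡⟨ regroup (c ^ q) (n ^ q) (c ^ p) (Z ^ p) ⟩
  c ^ q * c ^ p * (n ^ q * Z ^ p) * (c ^ q * c ^ p * (n ^ q * Z ^ p))
    ≡⟨ cong (λ K → K * (n ^ q * Z ^ p) * (K * (n ^ q * Z ^ p))) (^-distribˡ-+-* c q p) ⟨
  c ^ (q + p) * (n ^ q * Z ^ p) * (c ^ (q + p) * (n ^ q * Z ^ p)) ∎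
  where
  open ≤-Reasoning
  regroup : ∀ a b c d → a * a * (b * b) * (c * c * (d * d)) ≡ a * c * (b * d) * (a * c * (b * d))
  regroup = solve-∀

large-rad-bound : ∀ {A R m s n} q p .{{_ : NonZero s}} →
  6 * (A * m) ≤ 12 * n → 6 * m * s ≤ 12 * (A * R * (A * R)) →
  (R * s) ^ (q + q) ≤ (6 * m * s) ^ (q + q + p) →
  (A * R) ^ q ≤ 12 ^ (q + p) * (n ^ q * (A * R) ^ p)
large-rad-bound {A} {R} {m} {s} {n} q p 6Am≤12n 6ms≤12Z² c^Q≤[6ms]^[Q+p] = m*m≤n*n⇒m≤n (begin
  Z ^ q * Z ^ q                            ≡⟨ ^-distribˡ-+-* Z q q ⟨
  Z ^ Q                                    ≡⟨ ^-distribʳ-* A R Q ⟩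
  A ^ Q * R ^ Q                            ≤⟨ *-monoʳ-≤ (A ^ Q) (cancel-common-factor Q p c^Q≤[6ms]^[Q+p]) ⟩
  A ^ Q * ((6 * m) ^ Q * (6 * m * s) ^ p)  ≡⟨ *-assoc (A ^ Q) ((6 * m) ^ Q) ((6 * m * s) ^ p) ⟨
  A ^ Q * (6 * m) ^ Q * (6 * m * s) ^ p    ≡⟨ cong (_* (6 * m * s) ^ p) (^-distribʳ-* A (6 * m) Q) ⟨
  (A * (6 * m)) ^ Q * (6 * m * s) ^ p      ≡⟨ cong (λ x → x ^ Q * (6 * m * s) ^ p) (x∙yz≈y∙xz A 6 m) ⟩
  (6 * (A * m)) ^ Q * (6 * m * s) ^ p      ≤⟨ *-mono-≤ (^-monoˡ-≤ Q 6Am≤12n) (^-monoˡ-≤ p 6ms≤12Z²) ⟩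
  (12 * n) ^ Q * (12 * (Z * Z)) ^ p        ≤⟨ power-squares 12 n Z q p ⟩
  12 ^ (q + p) * (n ^ q * Z ^ p) * (12 ^ (q + p) * (n ^ q * Z ^ p)) ∎)
  where
  open ≤-Reasoning
  Q = q + q
  Z = A * R

module OrbitEstimates {j n : ℕ} .{{_ : NonZero n}} (n<2ʲ : n < 2 ^ j) (o : SingleEvenOrbit j n) where
  open SingleEvenOrbit o public
  open ≤-Reasoning

  A R Z : ℕ
  A = 2 ^ k
  R = 2 ^ suc r
  Z = A * R

  instance
    A≢0 : NonZero A
    A≢0 = m^n≢0 2 k
    R≢0 : NonZero R
    R≢0 = m^n≢0 2 (suc r)
    Z≢0 : NonZero Z
    Z≢0 = m*n≢0 A R
    m≢0 : NonZero m
    m≢0 = m*n≢0⇒n≢0 A {{subst NonZero 1+n≡2ᵏm _}}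
    s≢0 : NonZero s
    s≢0 = m*n≢0⇒n≢0 R {{subst NonZero 1+3ᵏm≡2ʳ⁺¹s _}}

  2ʲ≡Z : 2 ^ j ≡ Z
  2ʲ≡Z = trans (cong (2 ^_) j≡k+1+r) (^-distribˡ-+-* 2 k (suc r))

  3ᵏm>0 : 0 < 3 ^ k * m
  3ᵏm>0 = >-nonZero⁻¹ (3 ^ k * m) {{m*n≢0 (3 ^ k) m {{m^n≢0 3 k}}}}

  Am≤Z : A * m ≤ Z
  Am≤Z = subst₂ _≤_ 1+n≡2ᵏm 2ʲ≡Z n<2ʲ

  6Am≤12n : 6 * (A * m) ≤ 12 * n
  6Am≤12n = begin
    6 * (A * m)  ≡⟨ cong (6 *_) 1+n≡2ᵏm ⟨
    6 * suc n    ≤⟨ *-monoʳ-≤ 6 (+-monoˡ-≤ n (>-nonZero⁻¹ n)) ⟩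
    6 * (n + n)  ≡⟨ 6[n+n]≡12n n ⟩
    12 * n       ∎
    where
    6[n+n]≡12n : ∀ n → 6 * (n + n) ≡ 12 * n
    6[n+n]≡12n = solve-∀

  3ᵏm≤A²m : 3 ^ k * m ≤ A * A * m
  3ᵏm≤A²m = *-monoˡ-≤ m (≤-trans (^-monoˡ-≤ k (n≤1+n 3)) (≤-reflexive (^-distribʳ-* 2 2 k)))

  s≤2A²m : s ≤ 2 * (A * A) * m
  s≤2A²m = begin
    s                      ≤⟨ m≤n*m s R ⟩
    R * s                  ≡⟨ 1+3ᵏm≡2ʳ⁺¹s ⟨
    suc (3 ^ k * m)        ≤⟨ +-monoˡ-≤ (3 ^ k * m) 3ᵏm>0 ⟩
    3 ^ k * m + 3 ^ k * m  ≤⟨ +-mono-≤ 3ᵏm≤A²m 3ᵏm≤A²m ⟩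
    A * A * m + A * A * m  ≡⟨ x*m+x*m≡2*x*m (A * A) m ⟩
    2 * (A * A) * m        ∎
    where
    x*m+x*m≡2*x*m : ∀ x m → x * m + x * m ≡ 2 * x * m
    x*m+x*m≡2*x*m = solve-∀

  6ms≤12Z² : 6 * m * s ≤ 12 * (Z * Z)
  6ms≤12Z² = begin
    6 * m * s                  ≤⟨ *-monoʳ-≤ (6 * m) s≤2A²m ⟩
    6 * m * (2 * (A * A) * m)  ≡⟨ regroup A m ⟩
    12 * (A * m * (A * m))     ≤⟨ *-monoʳ-≤ 12 (*-mono-≤ Am≤Z Am≤Z) ⟩
    12 * (Z * Z)               ∎
    where
    regroup : ∀ a m → 6 * m * (2 * (a * a) * m) ≡ 12 * (a * m * (a * m))
    regroup = solve-∀

  rad≤6ms : rad (1 * (3 ^ k * m) * suc (3 ^ k * m)) ≤ 6 * m * s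
  rad≤6ms = subst (λ x → rad x ≤ 6 * m * s) (sym (cong₂ _*_ (*-identityˡ (3 ^ k * m)) 1+3ᵏm≡2ʳ⁺¹s))
    (rad[aᵏm*bᵗs]≤abms 3 2 k (suc r) m s {{m*n≢0 (6 * m) s {{m*n≢0 6 m}}}})

single-even-orbit-bound : ∀ {p q M j n} .{{_ : NonZero q}} .{{_ : NonZero n}} →
  ConsecutiveABC p (q + q) M → n < 2 ^ j → SingleEvenOrbit j n →
  (2 ^ j) ^ q ≤ n ^ q * (2 ^ j) ^ p * (12 ^ (q + p) * suc (2 * M)) ^ q
single-even-orbit-bound {p} {q} {M} {j} {n} consecutive n<2ʲ o =
  subst (λ Z → Z ^ q ≤ n ^ q * Z ^ p * b ^ q) (sym 2ʲ≡Z) (by-cases (consecutive (3 ^ k * m) 3ᵏm>0))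
  where
  open OrbitEstimates n<2ʲ o
  open ≤-Reasoning
  K = 12 ^ (q + p)
  b = K * suc (2 * M)
  instance
    K≢0 : NonZero K
    K≢0 = m^n≢0 12 (q + p)

  by-cases : suc (3 ^ k * m) ≤ M ⊎ suc (3 ^ k * m) ^ (q + q) ≤ rad (1 * (3 ^ k * m) * suc (3 ^ k * m)) ^ (q + q + p) →
    Z ^ q ≤ n ^ q * Z ^ p * b ^ q
  by-cases (inj₁ c≤M) = begin
    Z ^ q                    ≤⟨ ^-monoˡ-≤ q (small-exception-bound {A} {R} 1+n≡2ᵏm (subst (_≤ M) 1+3ᵏm≡2ʳ⁺¹s c≤M)) ⟩
    (n * (2 * M)) ^ q        ≡⟨ ^-distribʳ-* n (2 * M) q ⟩
    n ^ q * (2 * M) ^ q      ≤⟨ *-monoʳ-≤ (n ^ q) (m≤n⇒m≤o*n (Z ^ p) {{m^n≢0 Z p}} (^-monoˡ-≤ q (m≤n⇒m≤o*n K (n≤1+n (2 * M))))) ⟩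
    n ^ q * (Z ^ p * b ^ q)  ≡⟨ *-assoc (n ^ q) (Z ^ p) (b ^ q) ⟨
    n ^ q * Z ^ p * b ^ q    ∎
  by-cases (inj₂ c^Q≤rad^[Q+p]) = begin
    Z ^ q                    ≤⟨ large-rad-bound {A} {R} {m} {s} q p 6Am≤12n 6ms≤12Z² (begin
      (R * s) ^ (q + q)                                     ≡⟨ cong (_^ (q + q)) 1+3ᵏm≡2ʳ⁺¹s ⟨
      suc (3 ^ k * m) ^ (q + q)                             ≤⟨ c^Q≤rad^[Q+p] ⟩
      rad (1 * (3 ^ k * m) * suc (3 ^ k * m)) ^ (q + q + p) ≤⟨ ^-monoˡ-≤ (q + q + p) rad≤6ms ⟩
      (6 * m * s) ^ (q + q + p)                             ∎) ⟩
    K * (n ^ q * Z ^ p)      ≤⟨ *-monoˡ-≤ (n ^ q * Z ^ p) (≤-trans (m≤m*n K (suc (2 * M))) (m≤m^n b q {{m*n≢0 K (suc (2 * M))}})) ⟩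
    b ^ q * (n ^ q * Z ^ p)  ≡⟨ *-comm (b ^ q) (n ^ q * Z ^ p) ⟩
    n ^ q * Z ^ p * b ^ q    ∎

[2ʲ]^e≡2^[e*j] : ∀ e j → (2 ^ j) ^ e ≡ 2 ^ (e * j)
[2ʲ]^e≡2^[e*j] e j = trans (^-*-assoc 2 j e) (cong (2 ^_) (*-comm j e))

theorem1 : ABC → ∀ (p q : ℕ) → 0 < p → 0 < q →
    ∃₂ λ (a b : ℕ) → (0 < a) × (0 < b) ×
      (∀ (j n : ℕ) → 2 ≤ j → InN j n →
        a ^ q * 2 ^ (q * j) ≤ n ^ q * 2 ^ (p * j) * b ^ q)
theorem1 abc p q p>0 q>0 with abc⇒consecutiveABC abc p (q + q) p>0 (≤-trans q>0 (m≤m+n q q))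
... | M , consecutive = 1 , b , z<s , *-mono-≤ (m^n>0 12 (q + p)) z<s , bound
  where
  b = 12 ^ (q + p) * suc (2 * M)
  bound : ∀ j n → 2 ≤ j → InN j n → 1 ^ q * 2 ^ (q * j) ≤ n ^ q * 2 ^ (p * j) * b ^ q
  bound j n _ (n>0 , n<2ʲ , one) = subst₂ _≤_
    (trans ([2ʲ]^e≡2^[e*j] q j) (sym (trans (cong (_* 2 ^ (q * j)) (^-zeroˡ q)) (*-identityˡ _))))
    (cong (λ x → n ^ q * x * b ^ q) ([2ʲ]^e≡2^[e*j] p j))
    (single-even-orbit-bound {{>-nonZero q>0}} {{>-nonZero n>0}} consecutive n<2ʲ (single-even-orbit j n one))
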